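{- Let $K$ be a $2$-geodetic orientation of a complete bipartite graph $K_{s,t}$ with partite sets $X$ and $Y$, where $s \geq t \geq 2$. Then all arcs of $K$ are oriented in the same direction between the partite sets (all from $X$ to $Y$, or all from $Y$ to $X$), except for the arcs of a matching (possibly of size zero) which are oriented in the opposite direction.
   Context: A digraph has a vertex set and an arc set consisting of ordered pairs of distinct vertices. A walk of length $\ell$ is a sequence $x_0x_1\dots x_\ell$ of vertices with $x_i \rightarrow x_{i+1}$ for all $i$. A digraph is $k$-geodetic if for every ordered pair $(u,v)$ of (not necessarily distinct) vertices there is at most one $u,v$-walk of length at most $k$. An orientation of an undirected graph is obtained by assigning a direction to each edge. -}

module Defs where

open import Data.Nat using (ℕ; suc; _≤_)
open import Data.Bool using (Bool; true; false)
open import Data.Fin using (Fin)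
open import Data.Sum using (_⊎_; inj₁; inj₂)
open import Data.List using (List; []; _∷_; length)
open import Data.Empty using (⊥)
open import Data.Product using (_×_)
open import Relation.Nullary using (¬_)
open import Relation.Binary.PropositionalEquality using (_≡_)

-- A walk from u to v, recorded as its vertex sequence x₀ x₁ … x_ℓ
-- (a list of ℓ+1 vertices), with an arc x_i → x_{i+1} at each step.
data IsWalk {V : Set} (Arc : V → V → Set) : V → V → List V → Set where
  here : (v : V) → IsWalk Arc v v (v ∷ [])
  step : {u w v : V} {xs : List V} →
         Arc u w → IsWalk Arc w v xs → IsWalk Arc u v (u ∷ xs)

-- k-geodetic: for all ordered pairs (u,v) (not necessarily distinct),
-- there is at most one u,v-walk of length at most k (length = #vertices − 1).
KGeodetic : {V : Set} → ℕ → (V → V → Set) → Set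
KGeodetic {V} k Arc =
  (u v : V) (xs ys : List V) →
  IsWalk Arc u v xs → IsWalk Arc u v ys →
  length xs ≤ suc k → length ys ≤ suc k → xs ≡ ys

-- An orientation of K_{s,t} with partite sets X = Fin s, Y = Fin t:
-- o x y = true means the edge xy is oriented x → y, false means y → x.
Orientation : ℕ → ℕ → Set
Orientation s t = Fin s → Fin t → Bool

OArc : {s t : ℕ} → Orientation s t → (Fin s ⊎ Fin t) → (Fin s ⊎ Fin t) → Set
OArc o (inj₁ x) (inj₁ x') = ⊥
OArc o (inj₁ x) (inj₂ y)  = o x y ≡ true
OArc o (inj₂ y) (inj₁ x)  = o x y ≡ false
OArc o (inj₂ y) (inj₂ y') = ⊥

-- The set of edges xy whose orientation differs from direction d
-- (d = true: X → Y, d = false: Y → X) forms a matching: any two such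
-- edges sharing an endpoint are the same edge.
ExceptionsFormMatching : {s t : ℕ} → Orientation s t → Bool → Set
ExceptionsFormMatching {s} {t} o d =
  (x x' : Fin s) (y y' : Fin t) →
  ¬ (o x y ≡ d) → ¬ (o x' y' ≡ d) →
  (x ≡ x' → y ≡ y') × (y ≡ y' → x ≡ x')

{-# OPTIONS --safe #-}
module Submission where

open import Defs
open import Data.Nat using (ℕ; suc; _≤_; s≤s)
open import Data.Nat.Properties using (≤-refl; ≤-trans)
open import Data.Bool using (Bool; true; false; not)
import Data.Bool as Bool
open import Data.Bool.Properties using (¬-not; not-involutive)
open import Data.Sum using (_⊎_; inj₁; inj₂)
open import Data.Sum.Properties using (inj₁-injective; inj₂-injective)
open import Data.Fin using (Fin; zero; punchIn; _≟_)
open import Data.Fin.Properties using (any?; punchInᵢ≢i)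
open import Data.Product using (Σ; ∃; _×_; _,_)
open import Data.List.Properties using (∷-injectiveˡ; ∷-injectiveʳ)
open import Data.Empty using (⊥; ⊥-elim)
open import Function using (flip)
open import Relation.Nullary using (¬_; Dec; yes; no; contradiction)
open import Relation.Nullary.Decidable using (_×-dec_; _⊎-dec_; ¬?)
open import Relation.Binary.Definitions using (DecidableEquality)
open import Relation.Binary.PropositionalEquality using (_≡_; _≢_; ≢-sym; refl; subst; sym)

-- Read the orientation as a Boolean matrix with rows X and columns Y.  Two
-- distinct 2-walks x → y → x', x → y' → x' mean that rows x, x' are constant
-- and opposite on the columns y, y'; dually for columns.  So being 2-geodetic forbids
-- exactly such "striped" 2×2 submatrices.  If no direction d works, some row or
-- column repeats the value true and some row or column repeats false, and a short
-- case analysis (using s, t ≥ 2) produces a striped submatrix.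

private variable
  R C : Set
  b : Bool

≡-or-≡not : (u b : Bool) → u ≡ b ⊎ u ≡ not b
≡-or-≡not u b with u Bool.≟ b
... | yes u≡b = inj₁ u≡b
... | no u≢b = inj₂ (¬-not u≢b)

∃-≢ : ∀ {n} → 2 ≤ n → (i : Fin n) → ∃ λ j → j ≢ i
∃-≢ {suc (suc _)} _ i = punchIn i zero , punchInᵢ≢i i zero
∃-≢ {suc 0} (s≤s ()) _

twoStepWalk-unique : {V : Set} {Arc : V → V → Set} → KGeodetic 2 Arc →
                     ∀ {u v v' w} → Arc u v → Arc v w → Arc u v' → Arc v' w → v ≡ v'
twoStepWalk-unique geodetic uv vw uv' v'w =
  ∷-injectiveˡ (∷-injectiveʳ
    (geodetic _ _ _ _ (step uv (step vw (here _))) (step uv' (step v'w (here _)))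
              ≤-refl ≤-refl))

RowStripeFree : (R → C → Bool) → Set
RowStripeFree M = ∀ {b} x x' {y y'} →
  M x y ≡ b → M x y' ≡ b → M x' y ≡ not b → M x' y' ≡ not b → y ≡ y'

rowStripeFree-fromTrue : {M : R → C → Bool} →
  (∀ {x x' y y'} → M x y ≡ true → M x y' ≡ true → M x' y ≡ false → M x' y' ≡ false → y ≡ y') →
  RowStripeFree M
rowStripeFree-fromTrue free {true} _ _ = free
rowStripeFree-fromTrue free {false} _ _ xy xy' x'y x'y' = free x'y x'y' xy xy'

StripeFree : (R → C → Bool) → Set
StripeFree M = RowStripeFree M × RowStripeFree (flip M)

stripeFree-flip : {M : R → C → Bool} → StripeFree M → StripeFree (flip M)
stripeFree-flip (rows , columns) = columns , rows

geodetic⇒stripeFree : ∀ {s t} (o : Orientation s t) →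
                      KGeodetic 2 (OArc o) → StripeFree o
geodetic⇒stripeFree o geodetic =
  rowStripeFree-fromTrue {M = o} rows , rowStripeFree-fromTrue {M = flip o} columns
  where
  rows : ∀ {x x' y y'} → o x y ≡ true → o x y' ≡ true → o x' y ≡ false → o x' y' ≡ false → y ≡ y'
  rows {x} {x'} {y} {y'} xy xy' x'y x'y' =
    inj₂-injective (twoStepWalk-unique geodetic {u = inj₁ x} {w = inj₁ x'} xy x'y xy' x'y')
  columns : ∀ {y y' x x'} → o x y ≡ true → o x' y ≡ true → o x y' ≡ false → o x' y' ≡ false → x ≡ x'
  columns {y} {y'} {x} {x'} xy x'y xy' x'y' =
    inj₁-injective (twoStepWalk-unique geodetic {u = inj₂ y'} {w = inj₂ y} xy' xy x'y' x'y)

Repeats : {C : Set} → (C → Bool) → Bool → Set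
Repeats {C} f b = Σ C λ a → Σ C λ a' → a ≢ a' × f a ≡ b × f a' ≡ b

repeats-avoid : DecidableEquality C → {f : C → Bool} → Repeats f b →
                (c : C) → ∃ λ e → e ≢ c × f e ≡ b
repeats-avoid _≟C_ (a , a' , a≢a' , fa , fa') c with a ≟C c
... | yes refl = a' , ≢-sym a≢a' , fa'
... | no a≢c = a , a≢c , fa

rowStripeFree-propagate : {M : R → C → Bool} → RowStripeFree M →
  ∀ x x' {y y'} → y ≢ y' → M x y ≡ b → M x y' ≡ b → M x' y ≡ not b → M x' y' ≡ b
rowStripeFree-propagate {b = b} {M = M} free x x' {y' = y'} y≢y' xy xy' x'y
  with ≡-or-≡not (M x' y') b
... | inj₁ x'y' = x'y'
... | inj₂ x'y' = contradiction (free x x' xy xy' x'y x'y') y≢y'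

repeats-common : {M : R → C → Bool} → RowStripeFree M →
  ∀ {x} → Repeats (M x) b → ∀ w → ∃ λ e → M x e ≡ b × M w e ≡ b
repeats-common {b = b} {M = M} free {x} (a , a' , a≢a' , xa , xa') w
  with ≡-or-≡not (M w a) b | ≡-or-≡not (M w a') b
... | inj₁ wa | _ = a , xa , wa
... | inj₂ _ | inj₁ wa' = a' , xa' , wa'
... | inj₂ wa | inj₂ wa' = contradiction (free x w xa xa' wa wa') a≢a'

commonValue⇒¬repeats-not : {M : R → C → Bool} → StripeFree M →
  ∀ {z w e} → z ≢ w → M z e ≡ b → M w e ≡ b → ¬ Repeats (M z) (not b)
commonValue⇒¬repeats-not {b = b} {M = M} (rows , columns) {z} {w} {e} z≢w ze we
  (c , c' , c≢c' , zc , zc') = c≢c' (rows w z (opposite zc) (opposite zc') zc zc')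
  where
  opposite : ∀ {c} → M z c ≡ not b → M w c ≡ b
  opposite {c} = rowStripeFree-propagate columns e c z≢w ze we

rowRepeats-rowRepeats-conflict : {M : R → C → Bool} → StripeFree M →
  DecidableEquality R → (∀ r → ∃ λ r' → r' ≢ r) →
  ∀ {x z} → Repeats (M x) b → Repeats (M z) (not b) → ⊥
rowRepeats-rowRepeats-conflict sf@(rows , _) _≟R_ other {x} {z} rx rz with x ≟R z
... | yes refl =
  let (w , w≢x) = other x
      (e , xe , we) = repeats-common rows rx w
  in commonValue⇒¬repeats-not sf (≢-sym w≢x) xe we rz
... | no x≢z =
  let (e , xe , ze) = repeats-common rows rx z
  in commonValue⇒¬repeats-not sf (≢-sym x≢z) ze xe rz

repeats-crossing-conflict : {M : R → C → Bool} → StripeFree M → DecidableEquality C →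
  ∀ {x c} → Repeats (M x) b → Repeats (flip M c) (not b) → M x c ≡ b → ⊥
repeats-crossing-conflict {b = b} {M = M} (rows , columns) _≟C_ {x} {c}
  rx (z , z' , z≢z' , zc , z'c) xc with repeats-avoid _≟C_ rx c
... | e , e≢c , xe = z≢z' (columns e c (opposite zc) (opposite z'c) zc z'c)
  where
  opposite : ∀ {w} → M w c ≡ not b → M w e ≡ b
  opposite {w} = rowStripeFree-propagate rows x w (≢-sym e≢c) xc xe

rowRepeats-columnRepeats-conflict : {M : R → C → Bool} → StripeFree M →
  DecidableEquality R → DecidableEquality C →
  ∀ {x c} → Repeats (M x) b → Repeats (flip M c) (not b) → ⊥
rowRepeats-columnRepeats-conflict {b = b} {M = M} sf _≟R_ _≟C_ {x} {c} rx rc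
  with ≡-or-≡not (M x c) b
... | inj₁ xc = repeats-crossing-conflict sf _≟C_ rx rc xc
-- If the crossing entry carries the column's value, swap the roles in the transpose.
... | inj₂ xc = repeats-crossing-conflict (stripeFree-flip sf) _≟R_ rc
                  (subst (Repeats (M x)) (sym (not-involutive b)) rx) xc

Repeated : (R → C → Bool) → Bool → Set
Repeated M b = (∃ λ x → Repeats (M x) b) ⊎ (∃ λ y → Repeats (flip M y) b)

repeats? : ∀ {n} (f : Fin n → Bool) b → Dec (Repeats f b)
repeats? f b = any? λ a → any? λ a' → ¬? (a ≟ a') ×-dec f a Bool.≟ b ×-dec f a' Bool.≟ b

repeated? : ∀ {m n} (M : Fin m → Fin n → Bool) b → Dec (Repeated M b)
repeated? M b = any? (λ x → repeats? (M x) b) ⊎-dec any? (λ y → repeats? (flip M y) b)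

repeated-conflict : ∀ {m n} {M : Fin m → Fin n → Bool} → 2 ≤ m → 2 ≤ n → StripeFree M →
                    Repeated M b → Repeated M (not b) → ⊥
repeated-conflict 2≤m _ sf (inj₁ (_ , rx)) (inj₁ (_ , rz)) =
  rowRepeats-rowRepeats-conflict sf _≟_ (∃-≢ 2≤m) rx rz
repeated-conflict _ _ sf (inj₁ (_ , rx)) (inj₂ (_ , rc)) =
  rowRepeats-columnRepeats-conflict sf _≟_ _≟_ rx rc
repeated-conflict _ _ sf (inj₂ (_ , rc)) (inj₁ (_ , rx)) =
  rowRepeats-columnRepeats-conflict (stripeFree-flip sf) _≟_ _≟_ rc rx
repeated-conflict _ 2≤n sf (inj₂ (_ , rc)) (inj₂ (_ , rd)) =
  rowRepeats-rowRepeats-conflict (stripeFree-flip sf) _≟_ (∃-≢ 2≤n) rc rd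

¬repeated⇒exceptionsFormMatching : ∀ {s t} (o : Orientation s t) d →
  ¬ Repeated o (not d) → ExceptionsFormMatching o d
¬repeated⇒exceptionsFormMatching o d ¬repeated x x' y y' xy≢d x'y'≢d = sameRow , sameColumn
  where
  sameRow : x ≡ x' → y ≡ y'
  sameRow refl with y ≟ y'
  ... | yes y≡y' = y≡y'
  ... | no y≢y' = contradiction (inj₁ (x , y , y' , y≢y' , ¬-not xy≢d , ¬-not x'y'≢d)) ¬repeated
  sameColumn : y ≡ y' → x ≡ x'
  sameColumn refl with x ≟ x'
  ... | yes x≡x' = x≡x'
  ... | no x≢x' = contradiction (inj₂ (y , x , x' , x≢x' , ¬-not xy≢d , ¬-not x'y'≢d)) ¬repeated

theorem12 : (s t : ℕ) → 2 ≤ t → t ≤ s → (o : Orientation s t) →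
    KGeodetic {Fin s ⊎ Fin t} 2 (OArc o) →
    ∃ λ (d : Bool) → ExceptionsFormMatching o d
theorem12 s t 2≤t t≤s o geodetic with repeated? o false | repeated? o true
... | no ¬repeated | _ = true , ¬repeated⇒exceptionsFormMatching o true ¬repeated
... | yes _ | no ¬repeated = false , ¬repeated⇒exceptionsFormMatching o false ¬repeated
... | yes repeatedFalse | yes repeatedTrue =
  ⊥-elim (repeated-conflict (≤-trans 2≤t t≤s) 2≤t (geodetic⇒stripeFree o geodetic)
                            repeatedTrue repeatedFalse)
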